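{- Let $\mathcal X$ be a finite metric space with metric $d$ taking values in $\{0,1,\dots,n\}$, where $n=\operatorname{diam}(\mathcal X)$ is a positive integer, and assume $\mathcal X$ is distance-invariant, i.e. the cardinality of the metric ball $B(x,t)=\{y\in\mathcal X: d(x,y)\le t\}$ does not depend on the center $x$. Let $Z=\{z_1,\dots,z_N\}\subset\mathcal X$ be an $N$-point subset. Then $$D^{L_2}(Z)=\frac12\Big(\frac1{|\mathcal X|^2}\sum_{x,y\in\mathcal X}\sum_{u\in\mathcal X}|d(x,u)-d(y,u)|-\frac1{N^2}\sum_{i,j=1}^N\sum_{u\in\mathcal X}|d(z_i,u)-d(z_j,u)|\Big).$$
   Context: The quadratic discrepancy of $Z$ is $D^{L_2}(Z)=\sum_{t=0}^n D_t(Z)^2$, where $$D_t(Z)=\Big(\sum_{x\in\mathcal X}\Big(\frac1N\sum_{j=1}^N\mathbb 1_{B(x,t)}(z_j)-\frac{|B(x,t)|}{|\mathcal X|}\Big)^2\Big)^{1/2},$$ and $\mathbb 1_{B(x,t)}$ is the indicator function of the ball $B(x,t)$. -}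

module Defs where

open import Data.Nat using (ℕ; zero; suc; _≤_; _≤ᵇ_; NonZero; ∣_-_∣)
open import Data.Fin using (Fin; zero; suc)
open import Data.Bool using (Bool; true; false; if_then_else_)
open import Data.Integer using (+_)
open import Data.Rational using (ℚ; 0ℚ; _+_; _*_; _-_; _/_)
import Data.Nat.Properties
open import Data.Product using (_×_; ∃₂)
open import Relation.Binary.PropositionalEquality using (_≡_)

Σℚ : (k : ℕ) → (Fin k → ℚ) → ℚ
Σℚ zero    f = 0ℚ
Σℚ (suc k) f = f zero + Σℚ k (λ i → f (suc i))

Σℕ : (k : ℕ) → (Fin k → ℕ) → ℕ
Σℕ zero    f = 0
Σℕ (suc k) f = f zero Data.Nat.+ Σℕ k (λ i → f (suc i))

⟦_⟧ : ℕ → ℚ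
⟦ k ⟧ = + k / 1

-- Indicator 1_{B(x,t)}(y) = [d(x,y) ≤ t]
ind : ℕ → ℕ → ℕ
ind dist t = if dist ≤ᵇ t then 1 else 0

IsMetric : (m : ℕ) → (Fin m → Fin m → ℕ) → Set
IsMetric m d =
  (∀ x y → d x y ≡ 0 → x ≡ y) × (∀ x → d x x ≡ 0) ×
  (∀ x y → d x y ≡ d y x) × (∀ x y z → d x z ≤ d x y Data.Nat.+ d y z)

IsDiameter : (m : ℕ) → (Fin m → Fin m → ℕ) → ℕ → Set
IsDiameter m d n = (∀ x y → d x y ≤ n) × ∃₂ (λ x y → d x y ≡ n)

ballSize : (m : ℕ) → (Fin m → Fin m → ℕ) → Fin m → ℕ → ℕ
ballSize m d x t = Σℕ m (λ y → ind (d x y) t)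

DistanceInvariant : (m : ℕ) → (Fin m → Fin m → ℕ) → Set
DistanceInvariant m d = ∀ t x x′ → ballSize m d x t ≡ ballSize m d x′ t

Dt² : (m : ℕ) → .{{NonZero m}} → (Fin m → Fin m → ℕ) →
      (N : ℕ) → .{{NonZero N}} → (Fin N → Fin m) → ℕ → ℚ
Dt² m d N z t = Σℚ m (λ x →
  let e = + Σℕ N (λ j → ind (d x (z j)) t) / N - + ballSize m d x t / m
  in e * e)

DL2 : (m : ℕ) → .{{NonZero m}} → (Fin m → Fin m → ℕ) → ℕ →
      (N : ℕ) → .{{NonZero N}} → (Fin N → Fin m) → ℚ
DL2 m d n N z = Σℚ (suc n) (λ t → Dt² m d N z (Data.Fin.toℕ t))

energyX : (m : ℕ) → (Fin m → Fin m → ℕ) → ℕ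
energyX m d = Σℕ m (λ x → Σℕ m (λ y → Σℕ m (λ u → ∣ d x u - d y u ∣)))

energyZ : (m : ℕ) → (Fin m → Fin m → ℕ) → (N : ℕ) → (Fin N → Fin m) → ℕ
energyZ m d N z = Σℕ N (λ i → Σℕ N (λ j → Σℕ m (λ u → ∣ d (z i) u - d (z j) u ∣)))

_÷²_ : ℕ → (k : ℕ) → .{{NonZero k}} → ℚ
_÷²_ e k {{nz}} = _/_ (+ e) (k Data.Nat.* k) {{Data.Nat.Properties.m*n≢0 k k {{nz}} {{nz}}}}

module Submission where

-- Write β_t for the common volume |B(x,t)| and O_t(p,q) = |B(p,t) ∩ B(q,t)|.
-- (1) Expanding the square and counting incidences twice gives, for each t,
--       (Nm)² D_t(Z)² = m² Σ_{i,j} O_t(z_i,z_j) − m N² β_t²,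
--     and the same count for Z = X gives m β_t² = Σ_{x,y} O_t(x,y).
-- (2) Summing over the radii, a point u lies in B(p,t) ∩ B(q,t) for exactly
--     n + 1 − max(d(p,u),d(q,u)) radii t ≤ n; with 2 max(a,b) = a + b + |a − b|
--     and distance invariance (Σ_u d(p,u) does not depend on p) this gives
--       2 Σ_{t ≤ n} O_t(p,q) = κ − Σ_u |d(p,u) − d(q,u)|  for a constant κ.
-- (3) Inserting (2) into (1) for Z and for X, κ cancels and
--       2 (Nm)² D^{L₂}(Z) = N² E(X) − m² E(Z)
--     in ℤ; dividing by 2 (Nm)² in ℚ yields the theorem.

open import Defs
open import Data.Nat using (ℕ; _≤_; NonZero)
open import Data.Fin using (Fin)
open import Function.Definitions using (Injective)
open import Relation.Binary.PropositionalEquality using (_≡_)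

module Counting where

  open import Data.Nat as ℕ using (ℕ; zero; suc; _≤_; s≤s; _⊔_; ∣_-_∣)
  import Data.Nat.Properties as ℕP
  open import Data.Fin using (Fin; zero; suc; toℕ)
  open import Data.Integer as ℤ using (ℤ; +_; _+_; _*_; _-_; -_)
  import Data.Integer.Properties as ℤP
  open import Data.Integer.Tactic.RingSolver using (solve-∀)
  open import Relation.Binary.PropositionalEquality using (_≡_; refl; sym; trans; cong; cong₂; module ≡-Reasoning)
  open import Algebra.Properties.Semiring.Sum ℤP.+-*-semiring public
    using (sum; sum-syntax; sum⁺-syntax; sum-cong-≗; ∑-distrib-+; ∑-comm; *-distribˡ-sum; *-distribʳ-sum)

  ∑-cast : ∀ k (f : Fin k → ℕ) → + Σℕ k f ≡ ∑[ i < k ] (+ f i)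
  ∑-cast zero    f = refl
  ∑-cast (suc k) f = trans (ℤP.pos-+ (f zero) _) (cong (_+_ (+ f zero)) (∑-cast k (λ i → f (suc i))))

  ∑-const : ∀ k (c : ℤ) → ∑[ i < k ] c ≡ + k * c
  ∑-const zero    c = sym (ℤP.*-zeroˡ c)
  ∑-const (suc k) c = begin
    c + ∑[ i < k ] c    ≡⟨ cong (_+_ c) (∑-const k c) ⟩
    c + + k * c         ≡⟨ cong (λ w → w + + k * c) (ℤP.*-identityˡ c) ⟨
    + 1 * c + + k * c   ≡⟨ ℤP.*-distribʳ-+ c (+ 1) (+ k) ⟨
    + suc k * c         ∎
    where open ≡-Reasoning

  ∑-neg : ∀ k (f : Fin k → ℤ) → ∑[ i < k ] (- f i) ≡ - sum f
  ∑-neg k f = begin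
    ∑[ i < k ] (- f i)       ≡⟨ sum-cong-≗ (λ i → ℤP.-1*i≡-i (f i)) ⟨
    ∑[ i < k ] (ℤ.-1ℤ * f i) ≡⟨ *-distribˡ-sum ℤ.-1ℤ f ⟨
    ℤ.-1ℤ * sum f            ≡⟨ ℤP.-1*i≡-i (sum f) ⟩
    - sum f                  ∎
    where open ≡-Reasoning

  ∑-distrib-- : ∀ k (f g : Fin k → ℤ) → ∑[ i < k ] (f i - g i) ≡ sum f - sum g
  ∑-distrib-- k f g = trans (∑-distrib-+ f (λ i → - g i)) (cong (_+_ (sum f)) (∑-neg k g))

  ∑-product : ∀ k l (f : Fin k → ℤ) (g : Fin l → ℤ) →
    sum f * sum g ≡ ∑[ i < k ] ∑[ j < l ] (f i * g j)
  ∑-product k l f g = trans (*-distribʳ-sum (sum g) f) (sum-cong-≗ (λ i → *-distribˡ-sum (f i) g))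

  ∑-comm₃ : ∀ a b c (f : Fin a → Fin b → Fin c → ℤ) →
    ∑[ t < a ] ∑[ i < b ] ∑[ j < c ] f t i j ≡ ∑[ i < b ] ∑[ j < c ] ∑[ t < a ] f t i j
  ∑-comm₃ a b c f = trans (∑-comm (λ t i → ∑[ j < c ] f t i j)) (sum-cong-≗ (λ i → ∑-comm (λ t j → f t i j)))

  ∑-square-expand : ∀ k (f : Fin k → ℤ) (a c : ℤ) →
    ∑[ i < k ] ((f i * a - c) * (f i * a - c))
      ≡ a * a * ∑[ i < k ] (f i * f i) - (a + a) * c * sum f + + k * (c * c)
  ∑-square-expand k f a c = begin
    ∑[ i < k ] ((f i * a - c) * (f i * a - c))
      ≡⟨ sum-cong-≗ (λ i → square (f i) a c) ⟩
    ∑[ i < k ] (a * a * (f i * f i) - (a + a) * c * f i + c * c)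
      ≡⟨ ∑-distrib-+ (λ i → a * a * (f i * f i) - (a + a) * c * f i) (λ _ → c * c) ⟩
    ∑[ i < k ] (a * a * (f i * f i) - (a + a) * c * f i) + ∑[ i < k ] (c * c)
      ≡⟨ cong₂ _+_ (∑-distrib-- k (λ i → a * a * (f i * f i)) (λ i → (a + a) * c * f i)) (∑-const k (c * c)) ⟩
    ∑[ i < k ] (a * a * (f i * f i)) - ∑[ i < k ] ((a + a) * c * f i) + + k * (c * c)
      ≡⟨ cong₂ (λ u v → u - v + + k * (c * c))
           (*-distribˡ-sum (a * a) (λ i → f i * f i)) (*-distribˡ-sum ((a + a) * c) f) ⟨
    a * a * ∑[ i < k ] (f i * f i) - (a + a) * c * sum f + + k * (c * c) ∎
    where
    open ≡-Reasoning
    square : ∀ x a c → (x * a - c) * (x * a - c) ≡ a * a * (x * x) - (a + a) * c * x + c * c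
    square = solve-∀

  ∑∑-affine : ∀ k (κ : ℤ) (g e : Fin k → Fin k → ℤ) → (∀ i j → g i j + g i j ≡ κ - e i j) →
    ∑[ i < k ] ∑[ j < k ] g i j + ∑[ i < k ] ∑[ j < k ] g i j ≡ + k * + k * κ - ∑[ i < k ] ∑[ j < k ] e i j
  ∑∑-affine k κ g e double = begin
    ∑[ i < k ] ∑[ j < k ] g i j + ∑[ i < k ] ∑[ j < k ] g i j
      ≡⟨ ∑-distrib-+ (λ i → ∑[ j < k ] g i j) (λ i → ∑[ j < k ] g i j) ⟨
    ∑[ i < k ] (∑[ j < k ] g i j + ∑[ j < k ] g i j)
      ≡⟨ sum-cong-≗ (λ i → trans (sym (∑-distrib-+ (g i) (g i))) (sum-cong-≗ (double i))) ⟩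
    ∑[ i < k ] ∑[ j < k ] (κ - e i j)
      ≡⟨ trans (sum-cong-≗ {k} (λ i → ∑-distrib-- k (λ _ → κ) (e i))) (∑-distrib-- k _ _) ⟩
    ∑[ i < k ] (∑[ j < k ] κ) - ∑[ i < k ] ∑[ j < k ] e i j
      ≡⟨ cong (λ u → u - ∑[ i < k ] ∑[ j < k ] e i j)
           (trans (sum-cong-≗ {k} (λ _ → ∑-const k κ)) (trans (∑-const k (+ k * κ)) (sym (ℤP.*-assoc (+ k) (+ k) κ)))) ⟩
    + k * + k * κ - ∑[ i < k ] ∑[ j < k ] e i j ∎
    where open ≡-Reasoning

  ind-suc : ∀ a t → ind (suc a) (suc t) ≡ ind a t
  ind-suc zero    t = refl
  ind-suc (suc a) t = refl

  ind-⊔ : ∀ a b t → ind a t ℕ.* ind b t ≡ ind (a ⊔ b) t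
  ind-⊔ zero    zero    t       = refl
  ind-⊔ zero    (suc b) t       = ℕP.*-identityˡ (ind (suc b) t)
  ind-⊔ (suc a) zero    t       = ℕP.*-identityʳ (ind (suc a) t)
  ind-⊔ (suc a) (suc b) zero    = refl
  ind-⊔ (suc a) (suc b) (suc t) = begin
    ind (suc a) (suc t) ℕ.* ind (suc b) (suc t) ≡⟨ cong₂ ℕ._*_ (ind-suc a t) (ind-suc b t) ⟩
    ind a t ℕ.* ind b t                         ≡⟨ ind-⊔ a b t ⟩
    ind (a ⊔ b) t                               ≡⟨ ind-suc (a ⊔ b) t ⟨
    ind (suc a ⊔ suc b) (suc t)                 ∎
    where open ≡-Reasoning

  radii-count : ∀ k a → a ≤ k → + a + ∑[ t < k ] (+ ind a (toℕ t)) ≡ + k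
  radii-count zero    zero    _ = refl
  radii-count (suc k) zero    _ = trans (ℤP.+-identityˡ _) (cong (_+_ (+ 1)) (trans (∑-const k (+ 1)) (ℤP.*-identityʳ (+ k))))
  radii-count (suc k) (suc a) (s≤s a≤k) = begin
    + suc a + (+ 0 + ∑[ t < k ] (+ ind (suc a) (suc (toℕ t))))
      ≡⟨ cong (_+_ (+ suc a)) (trans (ℤP.+-identityˡ _) (sum-cong-≗ shift)) ⟩
    + 1 + + a + ∑[ t < k ] (+ ind a (toℕ t))
      ≡⟨ ℤP.+-assoc (+ 1) (+ a) (∑[ t < k ] (+ ind a (toℕ t))) ⟩
    + 1 + (+ a + ∑[ t < k ] (+ ind a (toℕ t)))
      ≡⟨ cong (_+_ (+ 1)) (radii-count k a a≤k) ⟩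
    + suc k ∎
    where
    open ≡-Reasoning
    shift : ∀ (t : Fin k) → + ind (suc a) (suc (toℕ t)) ≡ + ind a (toℕ t)
    shift t = cong +_ (ind-suc a (toℕ t))

  ⊔-double : ∀ a b → (a ⊔ b) ℕ.+ (a ⊔ b) ≡ a ℕ.+ b ℕ.+ ∣ a - b ∣
  ⊔-double zero    b       = refl
  ⊔-double (suc a) zero    = cong (λ w → suc (w ℕ.+ suc a)) (sym (ℕP.+-identityʳ a))
  ⊔-double (suc a) (suc b) = cong suc (begin
    (a ⊔ b) ℕ.+ suc (a ⊔ b)      ≡⟨ ℕP.+-suc (a ⊔ b) (a ⊔ b) ⟩
    suc ((a ⊔ b) ℕ.+ (a ⊔ b))    ≡⟨ cong suc (⊔-double a b) ⟩
    suc (a ℕ.+ b ℕ.+ ∣ a - b ∣)  ≡⟨ cong (λ w → w ℕ.+ ∣ a - b ∣) (ℕP.+-suc a b) ⟨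
    a ℕ.+ suc b ℕ.+ ∣ a - b ∣    ∎)
    where open ≡-Reasoning

module Fractions where

  open import Data.Nat as ℕ using (ℕ; zero; suc; NonZero)
  import Data.Nat.Properties as ℕP
  open import Data.Fin using (Fin; zero; suc)
  open import Data.Integer as ℤ using (ℤ; +_; _+_; _*_; _-_; -_)
  import Data.Integer.Properties as ℤP
  open import Data.Integer.Tactic.RingSolver using (solve-∀)
  open import Data.Rational as ℚ using (ℚ; _/_; ½)
  open import Data.Rational.Properties
    using (toℚᵘ-injective; toℚᵘ-fromℚᵘ; fromℚᵘ-cong; toℚᵘ-homo-+; toℚᵘ-homo-*; toℚᵘ-homo‿-; 0/n≡0)
  import Data.Rational.Unnormalised as ℚᵘ
  import Data.Rational.Unnormalised.Properties as ℚᵘP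
  open import Relation.Binary.PropositionalEquality using (_≡_; refl; sym; trans; cong; cong₂; module ≡-Reasoning)
  open Counting using (sum; sum-syntax)

  /-cross : ∀ (a b : ℤ) (p q : ℕ) .{{_ : NonZero p}} .{{_ : NonZero q}} →
            a * + q ≡ b * + p → a / p ≡ b / q
  /-cross a b (suc p) (suc q) eq = fromℚᵘ-cong {ℚᵘ.mkℚᵘ a p} {ℚᵘ.mkℚᵘ b q} (ℚᵘ.*≡* eq)

  /-+ : ∀ (a b : ℤ) (p q : ℕ) .{{_ : NonZero p}} .{{_ : NonZero q}} →
        a / p ℚ.+ b / q ≡ _/_ (a * + q + b * + p) (p ℕ.* q) {{ℕP.m*n≢0 p q}}
  /-+ a b (suc p) (suc q) = toℚᵘ-injective (ℚᵘP.≃-trans (toℚᵘ-homo-+ (a / suc p) (b / suc q))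
    (ℚᵘP.≃-trans (ℚᵘP.+-cong (toℚᵘ-fromℚᵘ (ℚᵘ.mkℚᵘ a p)) (toℚᵘ-fromℚᵘ (ℚᵘ.mkℚᵘ b q)))
    (ℚᵘP.≃-sym (toℚᵘ-fromℚᵘ _))))

  /-* : ∀ (a b : ℤ) (p q : ℕ) .{{_ : NonZero p}} .{{_ : NonZero q}} →
        a / p ℚ.* (b / q) ≡ _/_ (a * b) (p ℕ.* q) {{ℕP.m*n≢0 p q}}
  /-* a b (suc p) (suc q) = toℚᵘ-injective (ℚᵘP.≃-trans (toℚᵘ-homo-* (a / suc p) (b / suc q))
    (ℚᵘP.≃-trans (ℚᵘP.*-cong (toℚᵘ-fromℚᵘ (ℚᵘ.mkℚᵘ a p)) (toℚᵘ-fromℚᵘ (ℚᵘ.mkℚᵘ b q)))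
    (ℚᵘP.≃-sym (toℚᵘ-fromℚᵘ _))))

  /-neg : ∀ (a : ℤ) (p : ℕ) .{{_ : NonZero p}} → ℚ.- (a / p) ≡ (- a) / p
  /-neg a (suc p) = toℚᵘ-injective (ℚᵘP.≃-trans (toℚᵘ-homo‿- (a / suc p))
    (ℚᵘP.≃-trans (ℚᵘP.-‿cong (toℚᵘ-fromℚᵘ (ℚᵘ.mkℚᵘ a p))) (ℚᵘP.≃-sym (toℚᵘ-fromℚᵘ _))))

  /-difference : ∀ (a b : ℤ) (p q : ℕ) .{{_ : NonZero p}} .{{_ : NonZero q}} →
    a / p ℚ.- b / q ≡ _/_ (a * + q - b * + p) (p ℕ.* q) {{ℕP.m*n≢0 p q}}
  /-difference a b p q = begin
    a / p ℚ.+ ℚ.- (b / q)       ≡⟨ cong (ℚ._+_ (a / p)) (/-neg b q) ⟩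
    a / p ℚ.+ (- b) / q         ≡⟨ /-+ a (- b) p q ⟩
    _/_ (a * + q + (- b) * + p) (p ℕ.* q) {{ℕP.m*n≢0 p q}}
      ≡⟨ cong (λ c → _/_ (a * + q + c) (p ℕ.* q) {{ℕP.m*n≢0 p q}}) (ℤP.neg-distribˡ-* b (+ p)) ⟨
    _/_ (a * + q - b * + p) (p ℕ.* q) {{ℕP.m*n≢0 p q}} ∎
    where open ≡-Reasoning

  infixl 7 _/²_
  _/²_ : ℤ → (k : ℕ) → .{{NonZero k}} → ℚ
  _/²_ a k {{k≢0}} = _/_ a (k ℕ.* k) {{ℕP.m*n≢0 k k {{k≢0}} {{k≢0}}}}

  Σℚ-cong : ∀ k {f g : Fin k → ℚ} → (∀ i → f i ≡ g i) → Σℚ k f ≡ Σℚ k g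
  Σℚ-cong zero    f≗g = refl
  Σℚ-cong (suc k) f≗g = cong₂ ℚ._+_ (f≗g zero) (Σℚ-cong k (λ i → f≗g (suc i)))

  Σℚ-/ : ∀ k (f : Fin k → ℤ) (P : ℕ) .{{_ : NonZero P}} → Σℚ k (λ i → f i / P) ≡ sum f / P
  Σℚ-/ zero    f P = sym (0/n≡0 P)
  Σℚ-/ (suc k) f P = begin
    f zero / P ℚ.+ Σℚ k (λ i → f (suc i) / P)        ≡⟨ cong (ℚ._+_ (f zero / P)) (Σℚ-/ k (λ i → f (suc i)) P) ⟩
    f zero / P ℚ.+ s / P                              ≡⟨ /-+ (f zero) s P P ⟩
    _/_ (f zero * + P + s * + P) (P ℕ.* P) {{ℕP.m*n≢0 P P}}
      ≡⟨ /-cross (f zero * + P + s * + P) (f zero + s) (P ℕ.* P) P {{ℕP.m*n≢0 P P}}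
           (trans (cross (f zero) s (+ P)) (cong (_*_ (f zero + s)) (sym (ℤP.pos-* P P)))) ⟩
    (f zero + s) / P                                  ∎
    where
    open ≡-Reasoning
    s : ℤ
    s = ∑[ i < k ] f (suc i)
    cross : ∀ a s p → (a * p + s * p) * p ≡ (a + s) * (p * p)
    cross = solve-∀

  half-difference : ∀ (L : ℤ) (X Z p q : ℕ) .{{_ : NonZero p}} .{{_ : NonZero q}} →
    L + L ≡ + q * + q * + X - + p * + p * + Z →
    _/²_ L (q ℕ.* p) {{ℕP.m*n≢0 q p}} ≡ ½ ℚ.* ((X ÷² p) ℚ.- (Z ÷² q))
  half-difference L X Z p q 2L≡ = sym (begin
    ½ ℚ.* (+ X /² p ℚ.- + Z /² q)
      ≡⟨ cong (ℚ._*_ ½) (/-difference (+ X) (+ Z) (p ℕ.* p) (q ℕ.* q) {{ℕP.m*n≢0 p p}} {{ℕP.m*n≢0 q q}}) ⟩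
    ½ ℚ.* _/_ R (p ℕ.* p ℕ.* (q ℕ.* q)) {{ℕP.m*n≢0 (p ℕ.* p) (q ℕ.* q) {{ℕP.m*n≢0 p p}} {{ℕP.m*n≢0 q q}}}}
      ≡⟨ /-* (+ 1) R 2 (p ℕ.* p ℕ.* (q ℕ.* q)) {{_}} {{ℕP.m*n≢0 (p ℕ.* p) (q ℕ.* q) {{ℕP.m*n≢0 p p}} {{ℕP.m*n≢0 q q}}}} ⟩
    _/_ (+ 1 * R) (2 ℕ.* (p ℕ.* p ℕ.* (q ℕ.* q))) {{_}}
      ≡⟨ /-cross (+ 1 * R) L (2 ℕ.* (p ℕ.* p ℕ.* (q ℕ.* q))) (q ℕ.* p ℕ.* (q ℕ.* p)) {{_}} {{_}} (sym cross) ⟩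
    _/²_ L (q ℕ.* p) {{ℕP.m*n≢0 q p}} ∎)
    where
    open ≡-Reasoning
    R : ℤ
    R = + X * + (q ℕ.* q) - + Z * + (p ℕ.* p)
    cast₄ : ∀ a b c d → + (a ℕ.* b ℕ.* (c ℕ.* d)) ≡ + a * + b * (+ c * + d)
    cast₄ a b c d = trans (ℤP.pos-* (a ℕ.* b) (c ℕ.* d)) (cong₂ _*_ (ℤP.pos-* a b) (ℤP.pos-* c d))
    cross : L * + (2 ℕ.* (p ℕ.* p ℕ.* (q ℕ.* q))) ≡ + 1 * R * + (q ℕ.* p ℕ.* (q ℕ.* p))
    cross = begin
      L * + (2 ℕ.* (p ℕ.* p ℕ.* (q ℕ.* q)))
        ≡⟨ cong (_*_ L) (trans (ℤP.pos-* 2 (p ℕ.* p ℕ.* (q ℕ.* q))) (cong (_*_ (+ 2)) (cast₄ p p q q))) ⟩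
      L * (+ 2 * (+ p * + p * (+ q * + q)))
        ≡⟨ double L (+ p * + p * (+ q * + q)) ⟩
      (L + L) * (+ p * + p * (+ q * + q))
        ≡⟨ cong (λ u → u * (+ p * + p * (+ q * + q))) 2L≡ ⟩
      (+ q * + q * + X - + p * + p * + Z) * (+ p * + p * (+ q * + q))
        ≡⟨ rearrange (+ X) (+ Z) (+ p) (+ q) ⟩
      + 1 * (+ X * (+ q * + q) - + Z * (+ p * + p)) * (+ q * + p * (+ q * + p))
        ≡⟨ cong₂ (λ u v → + 1 * (+ X * u - + Z * v) * (+ q * + p * (+ q * + p))) (ℤP.pos-* q q) (ℤP.pos-* p p) ⟨
      + 1 * R * (+ q * + p * (+ q * + p))
        ≡⟨ cong (_*_ (+ 1 * R)) (cast₄ q p q p) ⟨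
      + 1 * R * + (q ℕ.* p ℕ.* (q ℕ.* p)) ∎
      where
      double : ∀ L c → L * (+ 2 * c) ≡ (L + L) * c
      double = solve-∀
      rearrange : ∀ X Z p q → (q * q * X - p * p * Z) * (p * p * (q * q)) ≡ + 1 * (X * (q * q) - Z * (p * p)) * (q * p * (q * p))
      rearrange = solve-∀

-- Geometry of a distance-invariant space X = Fin m, with symmetric
-- distance d bounded by n.  x₀ is any point: |B(x,t)| does not depend on it.
module DistanceInvariantSpace
  (m : ℕ) (d : Fin m → Fin m → ℕ) (n : ℕ)
  (d-sym : ∀ x y → d x y ≡ d y x) (d-bounded : ∀ x y → d x y ≤ n)
  (invariant : DistanceInvariant m d) (x₀ : Fin m) where

  open import Data.Nat as ℕ using (suc; _⊔_; ∣_-_∣)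
  import Data.Nat.Properties as ℕP
  open import Data.Fin using (toℕ)
  open import Relation.Binary.PropositionalEquality using (refl; sym; trans; cong; cong₂; module ≡-Reasoning)
  open import Data.Integer as ℤ using (ℤ; +_; _+_; _*_; _-_)
  import Data.Integer.Properties as ℤP
  open import Data.Integer.Tactic.RingSolver using (solve-∀)
  open import Data.Rational as ℚ using (ℚ; _/_)
  open Counting
  open Fractions

  𝟙 : Fin m → Fin m → ℕ → ℤ
  𝟙 p x t = + ind (d p x) t

  β : ℕ → ℤ
  β t = + ballSize m d x₀ t

  ball-volume : ∀ p t → ∑[ x < m ] 𝟙 p x t ≡ β t
  ball-volume p t = trans (sym (∑-cast m _)) (cong +_ (invariant t p x₀))

  intersection : ℕ → Fin m → Fin m → ℤ
  intersection t p q = ∑[ x < m ] (𝟙 p x t * 𝟙 q x t)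

  intersectionOverRadii : Fin m → Fin m → ℤ
  intersectionOverRadii p q = ∑[ t ≤ n ] intersection (toℕ t) p q

  gap : Fin m → Fin m → ℤ
  gap p q = ∑[ u < m ] (+ ∣ d p u - d q u ∣)

  radii-containing : ∀ p x → + d p x + ∑[ t ≤ n ] 𝟙 p x (toℕ t) ≡ + suc n
  radii-containing p x = radii-count (suc n) (d p x) (ℕP.m≤n⇒m≤1+n (d-bounded p x))

  ρ : ℤ
  ρ = + m * + suc n - ∑[ t ≤ n ] β (toℕ t)

  -- Σ_x d(p,x) = ρ does not depend on p: it is determined by the volumes.
  distance-sum : ∀ p → ∑[ x < m ] (+ d p x) ≡ ρ
  distance-sum p = solve-for (begin
    ∑[ x < m ] (+ d p x) + ∑[ t ≤ n ] β (toℕ t)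
      ≡⟨ cong (_+_ (∑[ x < m ] (+ d p x))) (sum-cong-≗ {suc n} (λ t → ball-volume p (toℕ t))) ⟨
    ∑[ x < m ] (+ d p x) + ∑[ t ≤ n ] ∑[ x < m ] 𝟙 p x (toℕ t)
      ≡⟨ cong (_+_ (∑[ x < m ] (+ d p x))) (∑-comm {suc n} (λ t x → 𝟙 p x (toℕ t))) ⟩
    ∑[ x < m ] (+ d p x) + ∑[ x < m ] ∑[ t ≤ n ] 𝟙 p x (toℕ t)
      ≡⟨ ∑-distrib-+ (λ x → + d p x) (λ x → ∑[ t ≤ n ] 𝟙 p x (toℕ t)) ⟨
    ∑[ x < m ] (+ d p x + ∑[ t ≤ n ] 𝟙 p x (toℕ t))
      ≡⟨ sum-cong-≗ (radii-containing p) ⟩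
    ∑[ x < m ] (+ suc n)
      ≡⟨ ∑-const m (+ suc n) ⟩
    + m * + suc n ∎)
    where
    open ≡-Reasoning
    solve-for : ∀ {s v k} → s + v ≡ k → s ≡ k - v
    solve-for refl = lemma _ _
      where lemma : ∀ s v → s ≡ s + v - v
            lemma = solve-∀

  commonRadii : Fin m → Fin m → Fin m → ℤ
  commonRadii p q x = ∑[ t ≤ n ] (𝟙 p x (toℕ t) * 𝟙 q x (toℕ t))

  -- x lies in B(p,t) ∩ B(q,t) for exactly n + 1 − max(d(p,x),d(q,x)) radii t ≤ n;
  -- doubled, with 2 max(a,b) = a + b + |a − b|:
  commonRadii-double : ∀ p q x →
    commonRadii p q x + commonRadii p q x ≡ (+ suc n + + suc n) - (+ d p x + + d q x + + ∣ d p x - d q x ∣)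
  commonRadii-double p q x = twice-complement (+ (a ⊔ b)) (commonRadii p q x) count double
    where
    a b : ℕ
    a = d p x
    b = d q x
    both-as-max : ∀ (t : Fin (suc n)) → 𝟙 p x (toℕ t) * 𝟙 q x (toℕ t) ≡ + ind (a ⊔ b) (toℕ t)
    both-as-max t = trans (sym (ℤP.pos-* (ind a (toℕ t)) (ind b (toℕ t)))) (cong +_ (ind-⊔ a b (toℕ t)))
    count : + (a ⊔ b) + commonRadii p q x ≡ + suc n
    count = trans (cong (_+_ (+ (a ⊔ b))) (sum-cong-≗ both-as-max))
                  (radii-count (suc n) (a ⊔ b) (ℕP.m≤n⇒m≤1+n (ℕP.⊔-lub (d-bounded p x) (d-bounded q x))))
    double : + (a ⊔ b) + + (a ⊔ b) ≡ + a + + b + + ∣ a - b ∣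
    double = trans (sym (ℤP.pos-+ (a ⊔ b) (a ⊔ b))) (trans (cong +_ (⊔-double a b))
               (trans (ℤP.pos-+ (a ℕ.+ b) _) (cong (λ w → w + + ∣ a - b ∣) (ℤP.pos-+ a b))))
    twice-complement : ∀ M S {K X} → M + S ≡ K → M + M ≡ X → S + S ≡ (K + K) - X
    twice-complement M S refl refl = lemma M S
      where lemma : ∀ M S → S + S ≡ ((M + S) + (M + S)) - (M + M)
            lemma = solve-∀

  κ : ℤ
  κ = + m * (+ suc n + + suc n) - (ρ + ρ)

  intersectionOverRadii-double : ∀ p q →
    intersectionOverRadii p q + intersectionOverRadii p q ≡ κ - gap p q
  intersectionOverRadii-double p q = begin
    J + J
      ≡⟨ cong (λ w → w + w) (∑-comm {suc n} (λ t x → 𝟙 p x (toℕ t) * 𝟙 q x (toℕ t))) ⟩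
    ∑[ x < m ] commonRadii p q x + ∑[ x < m ] commonRadii p q x
      ≡⟨ ∑-distrib-+ (commonRadii p q) (commonRadii p q) ⟨
    ∑[ x < m ] (commonRadii p q x + commonRadii p q x)
      ≡⟨ sum-cong-≗ (commonRadii-double p q) ⟩
    ∑[ x < m ] ((+ suc n + + suc n) - (+ d p x + + d q x + + ∣ d p x - d q x ∣))
      ≡⟨ ∑-distrib-- m (λ _ → + suc n + + suc n) (λ x → + d p x + + d q x + + ∣ d p x - d q x ∣) ⟩
    ∑[ x < m ] (+ suc n + + suc n) - ∑[ x < m ] (+ d p x + + d q x + + ∣ d p x - d q x ∣)
      ≡⟨ cong₂ _-_ (∑-const m (+ suc n + + suc n))
           (trans (∑-distrib-+ (λ x → + d p x + + d q x) (λ x → + ∣ d p x - d q x ∣))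
                  (cong (λ w → w + gap p q) (∑-distrib-+ (λ x → + d p x) (λ x → + d q x)))) ⟩
    + m * (+ suc n + + suc n) - (∑[ x < m ] (+ d p x) + ∑[ x < m ] (+ d q x) + gap p q)
      ≡⟨ cong (λ w → + m * (+ suc n + + suc n) - (w + gap p q)) (cong₂ _+_ (distance-sum p) (distance-sum q)) ⟩
    + m * (+ suc n + + suc n) - (ρ + ρ + gap p q)
      ≡⟨ regroup (+ m * (+ suc n + + suc n)) ρ (gap p q) ⟩
    κ - gap p q ∎
    where
    open ≡-Reasoning
    J : ℤ
    J = intersectionOverRadii p q
    regroup : ∀ K r e → K - (r + r + e) ≡ K - (r + r) - e
    regroup = solve-∀

  hits : (k : ℕ) → (Fin k → Fin m) → ℕ → Fin m → ℤ
  hits k w t x = ∑[ j < k ] 𝟙 (w j) x t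

  hits-total : ∀ k w t → ∑[ x < m ] hits k w t x ≡ + k * β t
  hits-total k w t = begin
    ∑[ x < m ] ∑[ j < k ] 𝟙 (w j) x t ≡⟨ ∑-comm {m} (λ x j → 𝟙 (w j) x t) ⟩
    ∑[ j < k ] ∑[ x < m ] 𝟙 (w j) x t ≡⟨ sum-cong-≗ (λ j → ball-volume (w j) t) ⟩
    ∑[ j < k ] β t                    ≡⟨ ∑-const k (β t) ⟩
    + k * β t                         ∎
    where open ≡-Reasoning

  hits-square : ∀ k w t →
    ∑[ x < m ] (hits k w t x * hits k w t x) ≡ ∑[ i < k ] ∑[ j < k ] intersection t (w i) (w j)
  hits-square k w t = begin
    ∑[ x < m ] (hits k w t x * hits k w t x)
      ≡⟨ sum-cong-≗ (λ x → ∑-product k k (λ i → 𝟙 (w i) x t) (λ j → 𝟙 (w j) x t)) ⟩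
    ∑[ x < m ] ∑[ i < k ] ∑[ j < k ] (𝟙 (w i) x t * 𝟙 (w j) x t)
      ≡⟨ ∑-comm₃ m k k (λ x i j → 𝟙 (w i) x t * 𝟙 (w j) x t) ⟩
    ∑[ i < k ] ∑[ j < k ] intersection t (w i) (w j) ∎
    where open ≡-Reasoning

  hits-everything : ∀ t x → hits m (λ y → y) t x ≡ β t
  hits-everything t x =
    trans (sum-cong-≗ (λ y → cong (λ r → + ind r t) (d-sym y x))) (ball-volume x t)

  volume-square : ∀ t → + m * (β t * β t) ≡ ∑[ x < m ] ∑[ y < m ] intersection t x y
  volume-square t = begin
    + m * (β t * β t)                 ≡⟨ ∑-const m (β t * β t) ⟨
    ∑[ x < m ] (β t * β t)            ≡⟨ sum-cong-≗ (λ x → cong₂ _*_ (hits-everything t x) (hits-everything t x)) ⟨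
    ∑[ x < m ] (hits m (λ y → y) t x * hits m (λ y → y) t x)
                                      ≡⟨ hits-square m (λ y → y) t ⟩
    ∑[ x < m ] ∑[ y < m ] intersection t x y ∎
    where open ≡-Reasoning

  -- N m (A/N − β/m) = m A − N β: the local discrepancy, scaled to be integral.
  deviation : (k : ℕ) → (Fin k → Fin m) → ℕ → Fin m → ℤ
  deviation k w t x = hits k w t x * + m - β t * + k

  deviation-square-sum : ∀ k w t →
    ∑[ x < m ] (deviation k w t x * deviation k w t x)
      ≡ + m * + m * ∑[ i < k ] ∑[ j < k ] intersection t (w i) (w j) - + k * + k * (+ m * (β t * β t))
  deviation-square-sum k w t = begin
    ∑[ x < m ] (deviation k w t x * deviation k w t x)
      ≡⟨ ∑-square-expand m (hits k w t) (+ m) (β t * + k) ⟩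
    + m * + m * ∑[ x < m ] (hits k w t x * hits k w t x)
      - (+ m + + m) * (β t * + k) * ∑[ x < m ] hits k w t x + + m * ((β t * + k) * (β t * + k))
      ≡⟨ cong₂ (λ u v → + m * + m * u - (+ m + + m) * (β t * + k) * v + + m * ((β t * + k) * (β t * + k)))
           (hits-square k w t) (hits-total k w t) ⟩
    + m * + m * S - (+ m + + m) * (β t * + k) * (+ k * β t) + + m * ((β t * + k) * (β t * + k))
      ≡⟨ collect (+ m) (+ k) (β t) S ⟩
    + m * + m * S - + k * + k * (+ m * (β t * β t)) ∎
    where
    open ≡-Reasoning
    S : ℤ
    S = ∑[ i < k ] ∑[ j < k ] intersection t (w i) (w j)
    collect : ∀ m k b S →
      m * m * S - (m + m) * (b * k) * (k * b) + m * ((b * k) * (b * k)) ≡ m * m * S - k * k * (m * (b * b))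
    collect = solve-∀

  pairSum : (k : ℕ) → (Fin k → Fin m) → (Fin m → Fin m → ℤ) → ℤ
  pairSum k w f = ∑[ i < k ] ∑[ j < k ] f (w i) (w j)

  scaledDiscrepancy : (k : ℕ) → (Fin k → Fin m) → ℤ
  scaledDiscrepancy k w = ∑[ t ≤ n ] ∑[ x < m ] (deviation k w (toℕ t) x * deviation k w (toℕ t) x)

  scaledDiscrepancy-intersections : ∀ k w →
    scaledDiscrepancy k w
      ≡ + m * + m * pairSum k w intersectionOverRadii - + k * + k * pairSum m (λ y → y) intersectionOverRadii
  scaledDiscrepancy-intersections k w = begin
    scaledDiscrepancy k w
      ≡⟨ sum-cong-≗ {suc n} (λ t → deviation-square-sum k w (toℕ t)) ⟩
    ∑[ t ≤ n ] (+ m * + m * S t - + k * + k * V t)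
      ≡⟨ ∑-distrib-- (suc n) (λ t → + m * + m * S t) (λ t → + k * + k * V t) ⟩
    ∑[ t ≤ n ] (+ m * + m * S t) - ∑[ t ≤ n ] (+ k * + k * V t)
      ≡⟨ cong₂ _-_ (*-distribˡ-sum (+ m * + m) S) (*-distribˡ-sum (+ k * + k) V) ⟨
    + m * + m * sum S - + k * + k * sum V
      ≡⟨ cong₂ (λ u v → + m * + m * u - + k * + k * v)
           (∑-comm₃ (suc n) k k (λ t i j → intersection (toℕ t) (w i) (w j)))
           (trans (sum-cong-≗ {suc n} (λ t → volume-square (toℕ t)))
                  (∑-comm₃ (suc n) m m (λ t x y → intersection (toℕ t) x y))) ⟩
    + m * + m * pairSum k w intersectionOverRadii - + k * + k * pairSum m (λ y → y) intersectionOverRadii ∎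
    where
    open ≡-Reasoning
    S V : Fin (suc n) → ℤ
    S t = ∑[ i < k ] ∑[ j < k ] intersection (toℕ t) (w i) (w j)
    V t = + m * (β (toℕ t) * β (toℕ t))

  count-as-hits : ∀ k (w : Fin k → Fin m) t x → + Σℕ k (λ j → ind (d x (w j)) t) ≡ hits k w t x
  count-as-hits k w t x = trans (∑-cast k _) (sum-cong-≗ {k} (λ j → cong (λ r → + ind r t) (d-sym x (w j))))

  ballSize-as-β : ∀ x t → + ballSize m d x t ≡ β t
  ballSize-as-β x t = cong +_ (invariant t x x₀)

  energy-as-pairSum : ∀ k (w : Fin k → Fin m) →
    + Σℕ k (λ i → Σℕ k (λ j → Σℕ m (λ u → ∣ d (w i) u - d (w j) u ∣))) ≡ pairSum k w gap
  energy-as-pairSum k w = trans (∑-cast k _) (sum-cong-≗ {k} (λ i → trans (∑-cast k _)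
    (sum-cong-≗ {k} (λ j → ∑-cast m (λ u → ∣ d (w i) u - d (w j) u ∣)))))

  discrepancy-as-fraction : ∀ .{{_ : NonZero m}} N .{{_ : NonZero N}} (z : Fin N → Fin m) →
    DL2 m d n N z ≡ _/²_ (scaledDiscrepancy N z) (N ℕ.* m) {{ℕP.m*n≢0 N m}}
  discrepancy-as-fraction N z = begin
    Σℚ (suc n) (λ t → Σℚ m (λ x → local (toℕ t) x ℚ.* local (toℕ t) x))
      ≡⟨ Σℚ-cong (suc n) (λ t → Σℚ-cong m (λ x → local-square (toℕ t) x)) ⟩
    Σℚ (suc n) (λ t → Σℚ m (λ x → (deviation N z (toℕ t) x * deviation N z (toℕ t) x) / P))
      ≡⟨ Σℚ-cong (suc n) (λ t → Σℚ-/ m (λ x → deviation N z (toℕ t) x * deviation N z (toℕ t) x) P) ⟩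
    Σℚ (suc n) (λ t → (∑[ x < m ] (deviation N z (toℕ t) x * deviation N z (toℕ t) x)) / P)
      ≡⟨ Σℚ-/ (suc n) (λ t → ∑[ x < m ] (deviation N z (toℕ t) x * deviation N z (toℕ t) x)) P ⟩
    scaledDiscrepancy N z / P ∎
    where
    open ≡-Reasoning
    P : ℕ
    P = N ℕ.* m ℕ.* (N ℕ.* m)
    instance
      Nm≢0 : NonZero (N ℕ.* m)
      Nm≢0 = ℕP.m*n≢0 N m
      P≢0 : NonZero P
      P≢0 = ℕP.m*n≢0 (N ℕ.* m) (N ℕ.* m)
    local : ℕ → Fin m → ℚ
    local t x = + Σℕ N (λ j → ind (d x (z j)) t) / N ℚ.- + ballSize m d x t / m
    local-square : ∀ t x → local t x ℚ.* local t x ≡ (deviation N z t x * deviation N z t x) / P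
    local-square t x = trans (cong (λ e → e ℚ.* e) local≡) (/-* (deviation N z t x) (deviation N z t x) (N ℕ.* m) (N ℕ.* m))
      where
      local≡ : local t x ≡ deviation N z t x / (N ℕ.* m)
      local≡ = trans (/-difference (+ Σℕ N (λ j → ind (d x (z j)) t)) (+ ballSize m d x t) N m)
        (cong₂ (λ a b → (a * + m - b * + N) / (N ℕ.* m)) (count-as-hits N z t x) (ballSize-as-β x t))

  -- Step (3): inserting 2J = κ − e for w and for the whole space, κ cancels:
  -- 2 (k m)² D^{L₂}(w) = k² E(X) − m² E(w).
  scaledDiscrepancy-energies : ∀ k w →
    scaledDiscrepancy k w + scaledDiscrepancy k w
      ≡ + k * + k * + energyX m d - + m * + m * + energyZ m d k w
  scaledDiscrepancy-energies k w = begin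
    L + L
      ≡⟨ cong (λ u → u + u) (scaledDiscrepancy-intersections k w) ⟩
    (+ m * + m * Jw - + k * + k * Jx) + (+ m * + m * Jw - + k * + k * Jx)
      ≡⟨ regroup (+ m) (+ k) Jw Jx ⟩
    + m * + m * (Jw + Jw) - + k * + k * (Jx + Jx)
      ≡⟨ cong₂ (λ u v → + m * + m * u - + k * + k * v)
           (∑∑-affine k κ (λ i j → intersectionOverRadii (w i) (w j)) (λ i j → gap (w i) (w j))
              (λ i j → intersectionOverRadii-double (w i) (w j)))
           (∑∑-affine m κ intersectionOverRadii gap intersectionOverRadii-double) ⟩
    + m * + m * (+ k * + k * κ - pairSum k w gap) - + k * + k * (+ m * + m * κ - pairSum m (λ y → y) gap)
      ≡⟨ cancel (+ m) (+ k) κ (pairSum k w gap) (pairSum m (λ y → y) gap) ⟩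
    + k * + k * pairSum m (λ y → y) gap - + m * + m * pairSum k w gap
      ≡⟨ cong₂ (λ ex ez → + k * + k * ex - + m * + m * ez) (energy-as-pairSum m (λ y → y)) (energy-as-pairSum k w) ⟨
    + k * + k * + energyX m d - + m * + m * + energyZ m d k w ∎
    where
    open ≡-Reasoning
    L Jw Jx : ℤ
    L = scaledDiscrepancy k w
    Jw = pairSum k w intersectionOverRadii
    Jx = pairSum m (λ y → y) intersectionOverRadii
    regroup : ∀ a b u v → (a * a * u - b * b * v) + (a * a * u - b * b * v) ≡ a * a * (u + u) - b * b * (v + v)
    regroup = solve-∀
    cancel : ∀ a b κ ew ex → a * a * (b * b * κ - ew) - b * b * (a * a * κ - ex) ≡ b * b * ex - a * a * ew
    cancel = solve-∀

open import Data.Rational using (_-_; ½)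
open import Data.Product using (_,_)
import Data.Nat as ℕ
import Data.Nat.Properties as ℕP
open Fractions using (_/²_; half-difference)

theorem2p1 : (m : ℕ) → .{{_ : NonZero m}} → (d : Fin m → Fin m → ℕ) → (n : ℕ) →
    IsMetric m d → IsDiameter m d n → 1 ≤ n → DistanceInvariant m d →
    (N : ℕ) → .{{_ : NonZero N}} → (z : Fin N → Fin m) → Injective _≡_ _≡_ z →
    DL2 m d n N z ≡
      Data.Rational._*_ ½ ((energyX m d ÷² m) - (energyZ m d N z ÷² N))
theorem2p1 m d n (_ , _ , d-sym , _) (d-bounded , _) _ invariant N z _ = begin
  DL2 m d n N z
    ≡⟨ discrepancy-as-fraction N z ⟩
  _/²_ (scaledDiscrepancy N z) (N ℕ.* m) {{ℕP.m*n≢0 N m}}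
    ≡⟨ half-difference (scaledDiscrepancy N z) (energyX m d) (energyZ m d N z) m N (scaledDiscrepancy-energies N z) ⟩
  Data.Rational._*_ ½ ((energyX m d ÷² m) - (energyZ m d N z ÷² N)) ∎
  where
  open Relation.Binary.PropositionalEquality.≡-Reasoning
  x₀ : Fin m
  x₀ = Data.Fin.fromℕ< (ℕ.>-nonZero⁻¹ m)
  open DistanceInvariantSpace m d n d-sym d-bounded invariant x₀
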